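{- Let $a,b$ be positive integers. If the $a$-$b$ chip-firing game is started with $n$ chips at vertex $0$ and reaches a state $\sigma$ by a finite sequence of firings, then $S_{\sigma^L}(\frac{b}{a})$ and $S_{\sigma^R}(\frac{b}{a})$ are integers.
   Context: The $a$-$b$ chip-firing game on $\mathbb{Z}$: a vertex $i$ with at least $a+b$ chips may fire, losing $a+b$ chips while vertex $i-1$ gains $a$ and vertex $i+1$ gains $b$. For a state $\sigma$ with $s_m$ chips at vertex $m$: $S_{\sigma^L}(t)=\sum_{m\le 0}s_mt^{ -m}$ and $S_{\sigma^R}(t)=\sum_{m\ge1}s_mt^{ -m}$. -}

module Defs where

open import Data.Nat as ℕ using (ℕ; zero; suc; NonZero)
open import Data.Integer as ℤ using (ℤ; +_; -[1+_]; ∣_∣)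
open import Data.Rational as ℚ using (ℚ)
open import Data.Bool using (if_then_else_)
open import Relation.Nullary.Decidable using (⌊_⌋)
open import Relation.Binary.PropositionalEquality using (_≡_)
open import Data.Product using (∃)

State : Set
State = ℤ → ℕ

initial : ℕ → State
initial n j = if ⌊ j ℤ.≟ + 0 ⌋ then n else 0

-- Firing vertex i in the a-b game: i loses a+b chips, i-1 gains a, i+1 gains b.
-- (Only applied when s i ≥ a + b, so truncated subtraction is exact.)
fire : (a b : ℕ) → State → ℤ → State
fire a b s i j =
  ((s j ℕ.∸ (if ⌊ j ℤ.≟ i ⌋ then a ℕ.+ b else 0))
     ℕ.+ (if ⌊ j ℤ.≟ i ℤ.- + 1 ⌋ then a else 0))
     ℕ.+ (if ⌊ j ℤ.≟ i ℤ.+ + 1 ⌋ then b else 0)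

data Reachable (a b : ℕ) (s₀ : State) : State → Set where
  start : Reachable a b s₀ s₀
  step  : ∀ {s} (i : ℤ) → Reachable a b s₀ s → a ℕ.+ b ℕ.≤ s i →
          Reachable a b s₀ (fire a b s i)

_^_ : ℚ → ℕ → ℚ
x ^ zero  = ℚ.1ℚ
x ^ suc k = x ℚ.* (x ^ k)

SupportedIn : State → ℕ → Set
SupportedIn s K = ∀ (j : ℤ) → K ℕ.< ∣ j ∣ → s j ≡ 0

-- Σ_{m = -K}^{0} s_m t^{-m}  =  Σ_{k=0}^{K} s_{-k} t^k
leftSum : State → ℚ → ℕ → ℚ
leftSum s t zero    = (+ s (+ 0)) ℚ./ 1
leftSum s t (suc k) = leftSum s t k ℚ.+ ((+ s (ℤ.- (+ suc k))) ℚ./ 1) ℚ.* (t ^ suc k)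

-- Σ_{m = 1}^{K} s_m t^{-m}; here u stands for t⁻¹, so this is Σ_{m=1}^{K} s_m u^m
rightSum : State → ℚ → ℕ → ℚ
rightSum s u zero    = ℚ.0ℚ
rightSum s u (suc k) = rightSum s u k ℚ.+ ((+ s (+ suc k)) ℚ./ 1) ℚ.* (u ^ suc k)

IsInteger : ℚ → Set
IsInteger q = ∃ λ (z : ℤ) → q ≡ z ℚ./ 1

-- Both sums are weighted chip counts Σⱼ σⱼ ω(j): for the left sum ω(j) = t^(-j) on j ≤ 0 with
-- t = b/a, for the right sum ω(j) = u^j on j ≥ 1 with u = a/b, and ω = 0 elsewhere. Firing i
-- changes such a count by a ω(i-1) + b ω(i+1) - (a+b) ω(i). Because a t = b (resp. b u = a)
-- the geometric weights are harmonic inside each ray, so this change is 0 there and ±a or 0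
-- near the origin: every firing changes both counts by an integer, and they start at n and 0.

module Submission where

open import Defs
open import Data.Nat using (ℕ; NonZero)
open import Data.Integer using (+_)
open import Data.Rational using (_/_)
open import Data.Product using (_×_; ∃)

open import Data.Bool using (if_then_else_)
open import Data.Integer as ℤ using (ℤ; +0; +[1+_]; -[1+_]; ∣_∣; _◃_)
import Data.Integer.Properties as ℤP
open import Data.List using (_∷_; [])
open import Data.Nat as ℕ using (zero; suc; z≤n; s≤s; _≤_; _<_; _≤′_; ≤′-reflexive; ≤′-step)
import Data.Nat.Properties as ℕP
open import Data.Nat.Tactic.RingSolver using () renaming (solve-∀ to ℕ-solve-∀)
open import Data.Product using (_,_)
open import Data.Rational as ℚ using (ℚ; 0ℚ; 1ℚ)
import Data.Rational.Properties as ℚP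
import Data.Rational.Unnormalised as ℚᵘ
import Data.Rational.Unnormalised.Properties as ℚᵘP
open import Data.Sign using (Sign)
open import Algebra.Properties.Group ℚP.+-0-group using (∙-cancelʳ; inverseʳ-unique)
open import Function using (_∘_)
open import Relation.Binary.PropositionalEquality
open import Relation.Nullary.Decidable using (Dec; ⌊_⌋; yes; no; dec⇒maybe)
open import Relation.Nullary.Negation using (contradiction)
open import Tactic.RingSolver using (solve-∀; solve)
import Tactic.RingSolver.Core.AlmostCommutativeRing as ACR

ℚ-ring : ACR.AlmostCommutativeRing _ _
ℚ-ring = ACR.fromCommutativeRing ℚP.+-*-commutativeRing (λ x → dec⇒maybe (0ℚ ℚP.≟ x))

fromℤ : ℤ → ℚ
fromℤ z = z / 1

fromℕ : ℕ → ℚ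
fromℕ n = fromℤ (+ n)

toℚᵘ-fromℤ : ∀ z → ℚ.toℚᵘ (fromℤ z) ℚᵘ.≃ ℚᵘ.mkℚᵘ z 0
toℚᵘ-fromℤ z = ℚP.toℚᵘ-fromℚᵘ (ℚᵘ.mkℚᵘ z 0)

fromℤ-unique : ∀ {p z} → ℚ.toℚᵘ p ℚᵘ.≃ ℚᵘ.mkℚᵘ z 0 → p ≡ fromℤ z
fromℤ-unique {z = z} p≃z = ℚP.toℚᵘ-injective (ℚᵘP.≃-trans p≃z (ℚᵘP.≃-sym (toℚᵘ-fromℤ z)))

fromℤ-+ : ∀ x y → fromℤ (x ℤ.+ y) ≡ fromℤ x ℚ.+ fromℤ y
fromℤ-+ x y = sym (fromℤ-unique (begin
    ℚ.toℚᵘ (fromℤ x ℚ.+ fromℤ y)            ≈⟨ ℚP.toℚᵘ-homo-+ (fromℤ x) (fromℤ y) ⟩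
    ℚ.toℚᵘ (fromℤ x) ℚᵘ.+ ℚ.toℚᵘ (fromℤ y)  ≈⟨ ℚᵘP.+-cong (toℚᵘ-fromℤ x) (toℚᵘ-fromℤ y) ⟩
    ℚᵘ.mkℚᵘ x 0 ℚᵘ.+ ℚᵘ.mkℚᵘ y 0           ≈⟨ ℚᵘ.*≡* (cong (ℤ._* + 1) (cong₂ ℤ._+_ (ℤP.*-identityʳ x)
                                                                                 (ℤP.*-identityʳ y))) ⟩
    ℚᵘ.mkℚᵘ (x ℤ.+ y) 0                     ∎))
  where open ℚᵘP.≃-Reasoning

fromℤ-* : ∀ x y → fromℤ (x ℤ.* y) ≡ fromℤ x ℚ.* fromℤ y
fromℤ-* x y = sym (fromℤ-unique (begin
    ℚ.toℚᵘ (fromℤ x ℚ.* fromℤ y)            ≈⟨ ℚP.toℚᵘ-homo-* (fromℤ x) (fromℤ y) ⟩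
    ℚ.toℚᵘ (fromℤ x) ℚᵘ.* ℚ.toℚᵘ (fromℤ y)  ≈⟨ ℚᵘP.*-cong (toℚᵘ-fromℤ x) (toℚᵘ-fromℤ y) ⟩
    ℚᵘ.mkℚᵘ (x ℤ.* y) 0                     ∎))
  where open ℚᵘP.≃-Reasoning

fromℤ-neg : ∀ x → fromℤ (ℤ.- x) ≡ ℚ.- fromℤ x
fromℤ-neg x = inverseʳ-unique (fromℤ x) (fromℤ (ℤ.- x))
  (trans (sym (fromℤ-+ x (ℤ.- x))) (cong fromℤ (ℤP.+-inverseʳ x)))

fromℕ-*-/-cancel : ∀ m n .{{_ : NonZero m}} → fromℕ m ℚ.* (+ n / m) ≡ fromℕ n
fromℕ-*-/-cancel (suc m) n = fromℤ-unique (begin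
    ℚ.toℚᵘ (fromℕ (suc m) ℚ.* (+ n / suc m))
      ≈⟨ ℚP.toℚᵘ-homo-* (fromℕ (suc m)) (+ n / suc m) ⟩
    ℚ.toℚᵘ (fromℕ (suc m)) ℚᵘ.* ℚ.toℚᵘ (+ n / suc m)
      ≈⟨ ℚᵘP.*-cong (toℚᵘ-fromℤ (+ suc m)) (ℚP.toℚᵘ-fromℚᵘ (ℚᵘ.mkℚᵘ (+ n) m)) ⟩
    ℚᵘ.mkℚᵘ (+ suc m) 0 ℚᵘ.* ℚᵘ.mkℚᵘ (+ n) m
      ≈⟨ ℚᵘ.*≡* (trans (ℤP.*-identityʳ _) (trans (ℤP.*-comm (+ suc m) (+ n))
                                                 (cong (+ n ℤ.*_) (sym (ℤP.*-identityˡ (+ suc m)))))) ⟩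
    ℚᵘ.mkℚᵘ (+ n) 0
      ∎)
  where open ℚᵘP.≃-Reasoning

IsInteger-+ : ∀ {p q} → IsInteger p → IsInteger q → IsInteger (p ℚ.+ q)
IsInteger-+ (x , refl) (y , refl) = x ℤ.+ y , sym (fromℤ-+ x y)

IsInteger-* : ∀ {p q} → IsInteger p → IsInteger q → IsInteger (p ℚ.* q)
IsInteger-* (x , refl) (y , refl) = x ℤ.* y , sym (fromℤ-* x y)

+-cancel-middle : ∀ {p q r} x → p ℚ.+ x ≡ q ℚ.+ (x ℚ.+ r) → p ≡ q ℚ.+ r
+-cancel-middle {p} {q} {r} x eq = ∙-cancelʳ x p (q ℚ.+ r) (trans eq (rearrange q x r))
  where
    rearrange : ∀ q x r → q ℚ.+ (x ℚ.+ r) ≡ q ℚ.+ r ℚ.+ x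
    rearrange = solve-∀ ℚ-ring

partialSum : (ℕ → ℚ) → ℕ → ℚ
partialSum f zero    = f zero
partialSum f (suc k) = partialSum f k ℚ.+ f (suc k)

module _ {f g : ℕ → ℚ} where

  partialSum-cong : (∀ k → f k ≡ g k) → ∀ K → partialSum f K ≡ partialSum g K
  partialSum-cong f≡g zero    = f≡g zero
  partialSum-cong f≡g (suc K) = cong₂ ℚ._+_ (partialSum-cong f≡g K) (f≡g (suc K))

  partialSum-+ : ∀ K → partialSum (λ k → f k ℚ.+ g k) K ≡ partialSum f K ℚ.+ partialSum g K
  partialSum-+ zero    = refl
  partialSum-+ (suc K) = trans (cong (ℚ._+ (f (suc K) ℚ.+ g (suc K))) (partialSum-+ K))
    (interchange (partialSum f K) (partialSum g K) (f (suc K)) (g (suc K)))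
    where
      interchange : ∀ w x y z → (w ℚ.+ x) ℚ.+ (y ℚ.+ z) ≡ (w ℚ.+ y) ℚ.+ (x ℚ.+ z)
      interchange = solve-∀ ℚ-ring

module _ {f : ℕ → ℚ} where

  partialSum-zero : ∀ {K} → (∀ k → k ≤ K → f k ≡ 0ℚ) → partialSum f K ≡ 0ℚ
  partialSum-zero {zero}  f≡0 = f≡0 0 z≤n
  partialSum-zero {suc K} f≡0 = cong₂ ℚ._+_
    (partialSum-zero λ k k≤K → f≡0 k (ℕP.m≤n⇒m≤1+n k≤K)) (f≡0 (suc K) ℕP.≤-refl)

  partialSum-stable : ∀ {K K′} → (∀ k → K < k → f k ≡ 0ℚ) → K ≤′ K′ →
                      partialSum f K′ ≡ partialSum f K
  partialSum-stable f≡0 (≤′-reflexive refl) = refl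
  partialSum-stable {K} {suc K′} f≡0 (≤′-step K≤K′) = begin
    partialSum f K′ ℚ.+ f (suc K′)
      ≡⟨ cong₂ ℚ._+_ (partialSum-stable f≡0 K≤K′) (f≡0 (suc K′) (s≤s (ℕP.≤′⇒≤ K≤K′))) ⟩
    partialSum f K ℚ.+ 0ℚ
      ≡⟨ ℚP.+-identityʳ _ ⟩
    partialSum f K
      ∎
    where open ≡-Reasoning

  partialSum-last : ∀ {K} → (∀ k → k < K → f k ≡ 0ℚ) → partialSum f K ≡ f K
  partialSum-last {zero}  _   = refl
  partialSum-last {suc K} f≡0 =
    trans (cong (ℚ._+ f (suc K)) (partialSum-zero λ k k≤K → f≡0 k (s≤s k≤K))) (ℚP.+-identityˡ _)

  partialSum-point : ∀ {k₀ K} → (∀ k → k ≢ k₀ → f k ≡ 0ℚ) → k₀ ≤ K → partialSum f K ≡ f k₀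
  partialSum-point f≡0 k₀≤K = trans
    (partialSum-stable (λ k k₀<k → f≡0 k (ℕP.>⇒≢ k₀<k)) (ℕP.≤⇒≤′ k₀≤K))
    (partialSum-last λ k k<k₀ → f≡0 k (ℕP.<⇒≢ k<k₀))

pile : ℤ → ℕ → State
pile j c x = if ⌊ x ℤ.≟ j ⌋ then c else 0

_⊕_ : State → State → State
(s ⊕ s′) j = s j ℕ.+ s′ j

pile-self : ∀ j c → pile j c j ≡ c
pile-self j c with j ℤ.≟ j
... | yes _   = refl
... | no j≢j = contradiction refl j≢j

pile-other : ∀ {j x} c → x ≢ j → pile j c x ≡ 0
pile-other {j} {x} c x≢j with x ℤ.≟ j
... | yes x≡j = contradiction x≡j x≢j
... | no _    = refl

pile-outside : ∀ {j x} c → ∣ j ∣ < ∣ x ∣ → pile j c x ≡ 0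
pile-outside c ∣j∣<∣x∣ = pile-other c (λ x≡j → ℕP.<⇒≢ ∣j∣<∣x∣ (cong ∣_∣ (sym x≡j)))

pile-≤ : ∀ {s : State} {j c} x → c ≤ s j → pile j c x ≤ s x
pile-≤ {j = j} x c≤sj with x ℤ.≟ j
... | yes refl = c≤sj
... | no _     = z≤n

SupportedIn-mono : ∀ {s K K′} → K ≤ K′ → SupportedIn s K → SupportedIn s K′
SupportedIn-mono K≤K′ supp j K′<∣j∣ = supp j (ℕP.≤-<-trans K≤K′ K′<∣j∣)

initial-supportedIn : ∀ n → SupportedIn (initial n) 0
initial-supportedIn n j 0<∣j∣ = pile-outside n 0<∣j∣

∣i-1∣≤1+∣i∣ : ∀ i → ∣ i ℤ.- + 1 ∣ ≤ suc ∣ i ∣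
∣i-1∣≤1+∣i∣ i = ℕP.≤-trans (ℤP.∣i-j∣≤∣i∣+∣j∣ i (+ 1)) (ℕP.≤-reflexive (ℕP.+-comm ∣ i ∣ 1))

∣i+1∣≤1+∣i∣ : ∀ i → ∣ i ℤ.+ + 1 ∣ ≤ suc ∣ i ∣
∣i+1∣≤1+∣i∣ i = ℕP.≤-trans (ℤP.∣i+j∣≤∣i∣+∣j∣ i (+ 1)) (ℕP.≤-reflexive (ℕP.+-comm ∣ i ∣ 1))

weightedChips : (ℤ → ℚ) → State → ℤ → ℚ
weightedChips ω s x = fromℕ (s x) ℚ.* ω x

weightedSum : Sign → (ℤ → ℚ) → State → ℕ → ℚ
weightedSum d ω s = partialSum (weightedChips ω s ∘ (d ◃_))

VanishesOffRay : Sign → (ℤ → ℚ) → Set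
VanishesOffRay d ω = ∀ j → j ≢ d ◃ ∣ j ∣ → ω j ≡ 0ℚ

module RaySum (d : Sign) (ω : ℤ → ℚ) where

  weightedChips-empty : ∀ (s : State) x → s x ≡ 0 → weightedChips ω s x ≡ 0ℚ
  weightedChips-empty s x sx≡0 = trans (cong (λ n → fromℕ n ℚ.* ω x) sx≡0) (ℚP.*-zeroˡ (ω x))

  weightedSum-cong : ∀ {s s′} → (∀ j → s j ≡ s′ j) → ∀ K → weightedSum d ω s K ≡ weightedSum d ω s′ K
  weightedSum-cong s≡s′ = partialSum-cong λ k → cong (λ n → fromℕ n ℚ.* ω (d ◃ k)) (s≡s′ (d ◃ k))

  weightedSum-⊕ : ∀ s s′ K →
                  weightedSum d ω (s ⊕ s′) K ≡ weightedSum d ω s K ℚ.+ weightedSum d ω s′ K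
  weightedSum-⊕ s s′ K = trans (partialSum-cong distrib K) (partialSum-+ K)
    where
      distrib : ∀ k → weightedChips ω (s ⊕ s′) (d ◃ k)
                    ≡ weightedChips ω s (d ◃ k) ℚ.+ weightedChips ω s′ (d ◃ k)
      distrib k = trans (cong (ℚ._* ω (d ◃ k)) (fromℤ-+ (+ s (d ◃ k)) (+ s′ (d ◃ k))))
                        (ℚP.*-distribʳ-+ (ω (d ◃ k)) (fromℕ (s (d ◃ k))) (fromℕ (s′ (d ◃ k))))

  weightedSum-stable : ∀ {s K K′} → SupportedIn s K → K ≤ K′ →
                       weightedSum d ω s K′ ≡ weightedSum d ω s K
  weightedSum-stable {s} {K} supp K≤K′ = partialSum-stable
    (λ k K<k → weightedChips-empty s (d ◃ k) (supp (d ◃ k) (subst (K <_) (sym (ℤP.abs-◃ d k)) K<k)))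
    (ℕP.≤⇒≤′ K≤K′)

  weightedSum-pile : VanishesOffRay d ω → ∀ {j K} c → ∣ j ∣ ≤ K →
                     weightedSum d ω (pile j c) K ≡ fromℕ c ℚ.* ω j
  weightedSum-pile off {j} c ∣j∣≤K = trans (partialSum-point elsewhere ∣j∣≤K) (at-∣j∣ (d ◃ ∣ j ∣ ℤ.≟ j))
    where
      elsewhere : ∀ k → k ≢ ∣ j ∣ → weightedChips ω (pile j c) (d ◃ k) ≡ 0ℚ
      elsewhere k k≢∣j∣ = weightedChips-empty (pile j c) (d ◃ k)
        (pile-other c λ e → k≢∣j∣ (trans (sym (ℤP.abs-◃ d k)) (cong ∣_∣ e)))
      at-∣j∣ : Dec (d ◃ ∣ j ∣ ≡ j) → weightedChips ω (pile j c) (d ◃ ∣ j ∣) ≡ fromℕ c ℚ.* ω j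
      at-∣j∣ (yes on-ray) = trans (cong (weightedChips ω (pile j c)) on-ray)
                                  (cong (λ n → fromℕ n ℚ.* ω j) (pile-self j c))
      at-∣j∣ (no off-ray) = begin
        weightedChips ω (pile j c) (d ◃ ∣ j ∣)
          ≡⟨ weightedChips-empty (pile j c) (d ◃ ∣ j ∣) (pile-other c off-ray) ⟩
        0ℚ
          ≡˘⟨ ℚP.*-zeroʳ (fromℕ c) ⟩
        fromℕ c ℚ.* 0ℚ
          ≡˘⟨ cong (fromℕ c ℚ.*_) (off j (off-ray ∘ sym)) ⟩
        fromℕ c ℚ.* ω j
          ∎
        where open ≡-Reasoning

module Firing (a b : ℕ) where

  fire-⊕-pile : ∀ {s i} → a ℕ.+ b ≤ s i →
    ∀ j → (fire a b s i ⊕ pile i (a ℕ.+ b)) j ≡ (s ⊕ (pile (i ℤ.- + 1) a ⊕ pile (i ℤ.+ + 1) b)) j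
  fire-⊕-pile {s} {i} fireable j = begin
    (s j ℕ.∸ m) ℕ.+ l ℕ.+ r ℕ.+ m    ≡⟨ shuffle (s j ℕ.∸ m) l r m ⟩
    (s j ℕ.∸ m) ℕ.+ m ℕ.+ (l ℕ.+ r)  ≡⟨ cong (ℕ._+ (l ℕ.+ r)) (ℕP.m∸n+n≡m (pile-≤ j fireable)) ⟩
    s j ℕ.+ (l ℕ.+ r)                ∎
    where
      open ≡-Reasoning
      m l r : ℕ
      m = pile i (a ℕ.+ b) j
      l = pile (i ℤ.- + 1) a j
      r = pile (i ℤ.+ + 1) b j
      shuffle : ∀ x l r m → x ℕ.+ l ℕ.+ r ℕ.+ m ≡ x ℕ.+ m ℕ.+ (l ℕ.+ r)
      shuffle = ℕ-solve-∀

  fire-supportedIn : ∀ {s K i} → SupportedIn s K → ∣ i ∣ ≤ K → SupportedIn (fire a b s i) (suc K)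
  fire-supportedIn {s} {K} {i} supp ∣i∣≤K j K+1<∣j∣ = all-zero
    (supp j K<∣j∣)
    (pile-outside {i} {j} (a ℕ.+ b) (ℕP.≤-<-trans ∣i∣≤K K<∣j∣))
    (pile-outside {i ℤ.- + 1} {j} a (neighbour {i ℤ.- + 1} (∣i-1∣≤1+∣i∣ i)))
    (pile-outside {i ℤ.+ + 1} {j} b (neighbour {i ℤ.+ + 1} (∣i+1∣≤1+∣i∣ i)))
    where
      all-zero : ∀ {w x y z} → w ≡ 0 → x ≡ 0 → y ≡ 0 → z ≡ 0 → w ℕ.∸ x ℕ.+ y ℕ.+ z ≡ 0
      all-zero refl refl refl refl = refl
      K<∣j∣ : K < ∣ j ∣
      K<∣j∣ = ℕP.<-trans (ℕP.n<1+n K) K+1<∣j∣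
      neighbour : ∀ {x} → ∣ x ∣ ≤ suc ∣ i ∣ → ∣ x ∣ < ∣ j ∣
      neighbour ∣x∣≤ = ℕP.≤-<-trans (ℕP.≤-trans ∣x∣≤ (s≤s ∣i∣≤K)) K+1<∣j∣

  fireable⇒inSupport : ∀ {s K i} .{{_ : NonZero a}} → SupportedIn s K → a ℕ.+ b ≤ s i → ∣ i ∣ ≤ K
  fireable⇒inSupport {s} {K} {i} supp fireable = ℕP.≮⇒≥ λ K<∣i∣ →
    ℕP.<⇒≱ (ℕP.≤-trans (ℕ.>-nonZero⁻¹ a) (ℕP.m≤m+n a b)) (subst (a ℕ.+ b ≤_) (supp i K<∣i∣) fireable)

  reachable-supportedIn : ∀ {s₀ K σ} .{{_ : NonZero a}} →
    SupportedIn s₀ K → Reachable a b s₀ σ → ∃ λ K′ → SupportedIn σ K′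
  reachable-supportedIn supp start = _ , supp
  reachable-supportedIn supp (step i r fireable) with reachable-supportedIn supp r
  ... | K′ , supp′ = suc K′ , fire-supportedIn supp′ (fireable⇒inSupport supp′ fireable)

  weightedSum-fire : ∀ {d ω s i K} → VanishesOffRay d ω → a ℕ.+ b ≤ s i → suc ∣ i ∣ ≤ K →
    weightedSum d ω (fire a b s i) K ℚ.+ (fromℕ a ℚ.+ fromℕ b) ℚ.* ω i
      ≡ weightedSum d ω s K ℚ.+ (fromℕ a ℚ.* ω (i ℤ.- + 1) ℚ.+ fromℕ b ℚ.* ω (i ℤ.+ + 1))
  weightedSum-fire {d} {ω} {s} {i} {K} off fireable ∣i∣<K = begin
    W (fire a b s i) ℚ.+ (fromℕ a ℚ.+ fromℕ b) ℚ.* ω i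
      ≡˘⟨ cong (W (fire a b s i) ℚ.+_) (trans (weightedSum-pile off (a ℕ.+ b) (ℕP.<⇒≤ ∣i∣<K))
                                              (cong (ℚ._* ω i) (fromℤ-+ (+ a) (+ b)))) ⟩
    W (fire a b s i) ℚ.+ W (pile i (a ℕ.+ b))
      ≡˘⟨ weightedSum-⊕ (fire a b s i) (pile i (a ℕ.+ b)) K ⟩
    W (fire a b s i ⊕ pile i (a ℕ.+ b))
      ≡⟨ weightedSum-cong (fire-⊕-pile fireable) K ⟩
    W (s ⊕ (left ⊕ right))
      ≡⟨ weightedSum-⊕ s (left ⊕ right) K ⟩
    W s ℚ.+ W (left ⊕ right)
      ≡⟨ cong (W s ℚ.+_) (weightedSum-⊕ left right K) ⟩
    W s ℚ.+ (W left ℚ.+ W right)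
      ≡⟨ cong (W s ℚ.+_) (cong₂ ℚ._+_ (weightedSum-pile off a (ℕP.≤-trans (∣i-1∣≤1+∣i∣ i) ∣i∣<K))
                                      (weightedSum-pile off b (ℕP.≤-trans (∣i+1∣≤1+∣i∣ i) ∣i∣<K))) ⟩
    W s ℚ.+ (fromℕ a ℚ.* ω (i ℤ.- + 1) ℚ.+ fromℕ b ℚ.* ω (i ℤ.+ + 1))
      ∎
    where
      open ≡-Reasoning
      open RaySum d ω
      W : State → ℚ
      W σ = weightedSum d ω σ K
      left right : State
      left  = pile (i ℤ.- + 1) a
      right = pile (i ℤ.+ + 1) b

  HasIntegralLaplacian : (ℤ → ℚ) → Set
  HasIntegralLaplacian ω = ∀ i → ∃ λ z →
    fromℕ a ℚ.* ω (i ℤ.- + 1) ℚ.+ fromℕ b ℚ.* ω (i ℤ.+ + 1) ≡ (fromℕ a ℚ.+ fromℕ b) ℚ.* ω i ℚ.+ fromℤ z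

  weightedSum-isInteger : ∀ {d ω n σ} .{{_ : NonZero a}} →
    VanishesOffRay d ω → HasIntegralLaplacian ω → IsInteger (ω +0) →
    Reachable a b (initial n) σ → ∀ K → SupportedIn σ K → IsInteger (weightedSum d ω σ K)
  weightedSum-isInteger {d} {ω} {n} off _ ω₀ start K _ =
    subst IsInteger (sym (RaySum.weightedSum-pile d ω off {+0} {K} n z≤n)) (IsInteger-* (+ n , refl) ω₀)
  weightedSum-isInteger {d} {ω} {n} off Δ ω₀ (step {s} i r fireable) K supp
    with reachable-supportedIn (initial-supportedIn n) r | Δ i
  ... | K₀ , supp₀ | z , Δi≡z =
    subst IsInteger (sym fired) (IsInteger-+ (weightedSum-isInteger off Δ ω₀ r M suppM) (z , refl))
    where
      M : ℕ
      M = K ℕ.+ suc K₀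
      suppM : SupportedIn s M
      suppM = SupportedIn-mono (ℕP.≤-trans (ℕP.n≤1+n K₀) (ℕP.m≤n+m (suc K₀) K)) supp₀
      ∣i∣<M : suc ∣ i ∣ ≤ M
      ∣i∣<M = ℕP.≤-trans (s≤s (fireable⇒inSupport supp₀ fireable)) (ℕP.m≤n+m (suc K₀) K)
      fired : weightedSum d ω (fire a b s i) K ≡ weightedSum d ω s M ℚ.+ fromℤ z
      fired = trans (sym (RaySum.weightedSum-stable d ω supp (ℕP.m≤m+n K (suc K₀))))
        (+-cancel-middle {q = weightedSum d ω s M} {r = fromℤ z} _
          (trans (weightedSum-fire off fireable ∣i∣<M) (cong (weightedSum d ω s M ℚ.+_) Δi≡z)))

leftWeight : ℚ → ℤ → ℚ
leftWeight t +0       = 1ℚ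
leftWeight t +[1+ _ ] = 0ℚ
leftWeight t -[1+ m ] = t ^ suc m

rightWeight : ℚ → ℤ → ℚ
rightWeight u +0       = 0ℚ
rightWeight u +[1+ m ] = u ^ suc m
rightWeight u -[1+ _ ] = 0ℚ

leftWeight-vanishesOffRay : ∀ t → VanishesOffRay Sign.- (leftWeight t)
leftWeight-vanishesOffRay t +0       off = contradiction refl off
leftWeight-vanishesOffRay t +[1+ _ ] _   = refl
leftWeight-vanishesOffRay t -[1+ _ ] off = contradiction refl off

rightWeight-vanishesOffRay : ∀ u → VanishesOffRay Sign.+ (rightWeight u)
rightWeight-vanishesOffRay u +0       _   = refl
rightWeight-vanishesOffRay u +[1+ _ ] off = contradiction refl off
rightWeight-vanishesOffRay u -[1+ _ ] _   = refl

leftSum≡weightedSum : ∀ s t K → leftSum s t K ≡ weightedSum Sign.- (leftWeight t) s K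
leftSum≡weightedSum s t zero    = sym (ℚP.*-identityʳ (fromℕ (s +0)))
leftSum≡weightedSum s t (suc K) =
  cong (ℚ._+ fromℕ (s -[1+ K ]) ℚ.* t ^ suc K) (leftSum≡weightedSum s t K)

rightSum≡weightedSum : ∀ s u K → rightSum s u K ≡ weightedSum Sign.+ (rightWeight u) s K
rightSum≡weightedSum s u zero    = sym (ℚP.*-zeroʳ (fromℕ (s +0)))
rightSum≡weightedSum s u (suc K) =
  cong (ℚ._+ fromℕ (s +[1+ K ]) ℚ.* u ^ suc K) (rightSum≡weightedSum s u K)

zero-weights-balance : ∀ A B → A ℚ.* 0ℚ ℚ.+ B ℚ.* 0ℚ ≡ (A ℚ.+ B) ℚ.* 0ℚ ℚ.+ 0ℚ
zero-weights-balance = solve-∀ ℚ-ring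

geometric-balance : ∀ A r T {B} → A ℚ.* r ≡ B →
  A ℚ.* (r ℚ.* (r ℚ.* T)) ℚ.+ B ℚ.* T ≡ (A ℚ.+ B) ℚ.* (r ℚ.* T) ℚ.+ 0ℚ
geometric-balance A r T refl = solve (A ∷ r ∷ T ∷ []) ℚ-ring

module _ (a b : ℕ) where
  open Firing a b

  leftWeight-laplacian : ∀ {t} → fromℕ a ℚ.* t ≡ fromℕ b → HasIntegralLaplacian (leftWeight t)
  leftWeight-laplacian {t} at≡b +0 = ℤ.- (+ a) , trans (origin (fromℕ a) t at≡b)
    (cong ((fromℕ a ℚ.+ fromℕ b) ℚ.* 1ℚ ℚ.+_) (sym (fromℤ-neg (+ a))))
    where
      origin : ∀ A t {B} → A ℚ.* t ≡ B → A ℚ.* (t ℚ.* 1ℚ) ℚ.+ B ℚ.* 0ℚ ≡ (A ℚ.+ B) ℚ.* 1ℚ ℚ.+ ℚ.- A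
      origin A t refl = solve (A ∷ t ∷ []) ℚ-ring
  leftWeight-laplacian at≡b +[1+ 0 ] = + a , unit (fromℕ a) (fromℕ b)
    where
      unit : ∀ A B → A ℚ.* 1ℚ ℚ.+ B ℚ.* 0ℚ ≡ (A ℚ.+ B) ℚ.* 0ℚ ℚ.+ A
      unit = solve-∀ ℚ-ring
  leftWeight-laplacian at≡b +[1+ suc _ ] = +0 , zero-weights-balance (fromℕ a) (fromℕ b)
  leftWeight-laplacian {t} at≡b -[1+ 0 ] = +0 , geometric-balance (fromℕ a) t 1ℚ at≡b
  -- Here i - 1 normalises to -[1+ suc (suc (m ℕ.+ 0)) ].
  leftWeight-laplacian {t} at≡b -[1+ suc m ] rewrite ℕP.+-identityʳ m =
    +0 , geometric-balance (fromℕ a) t (t ^ suc m) at≡b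

  rightWeight-laplacian : ∀ {u} → fromℕ b ℚ.* u ≡ fromℕ a → HasIntegralLaplacian (rightWeight u)
  rightWeight-laplacian bu≡a -[1+ 0 ]     = +0 , zero-weights-balance (fromℕ a) (fromℕ b)
  rightWeight-laplacian bu≡a -[1+ suc _ ] = +0 , zero-weights-balance (fromℕ a) (fromℕ b)
  rightWeight-laplacian {u} bu≡a +0 = + a , first-site (fromℕ b) u bu≡a
    where
      first-site : ∀ B u {A} → B ℚ.* u ≡ A → A ℚ.* 0ℚ ℚ.+ B ℚ.* (u ℚ.* 1ℚ) ≡ (A ℚ.+ B) ℚ.* 0ℚ ℚ.+ A
      first-site B u refl = solve (B ∷ u ∷ []) ℚ-ring
  rightWeight-laplacian {u} bu≡a +[1+ 0 ] = ℤ.- (+ a) , trans (second-site (fromℕ b) u bu≡a)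
    (cong ((fromℕ a ℚ.+ fromℕ b) ℚ.* (u ℚ.* 1ℚ) ℚ.+_) (sym (fromℤ-neg (+ a))))
    where
      second-site : ∀ B u {A} → B ℚ.* u ≡ A →
        A ℚ.* 0ℚ ℚ.+ B ℚ.* (u ℚ.* (u ℚ.* 1ℚ)) ≡ (A ℚ.+ B) ℚ.* (u ℚ.* 1ℚ) ℚ.+ ℚ.- A
      second-site B u refl = solve (B ∷ u ∷ []) ℚ-ring
  -- Here i + 1 normalises to +[1+ suc (m ℕ.+ 1) ].
  rightWeight-laplacian {u} bu≡a +[1+ suc m ] rewrite ℕP.+-comm m 1 =
    +0 , mirrored-geometric-balance (fromℕ b) u (u ^ suc m) bu≡a
    where
      mirrored-geometric-balance : ∀ B r T {A} → B ℚ.* r ≡ A →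
        A ℚ.* T ℚ.+ B ℚ.* (r ℚ.* (r ℚ.* T)) ≡ (A ℚ.+ B) ℚ.* (r ℚ.* T) ℚ.+ 0ℚ
      mirrored-geometric-balance B r T refl = solve (B ∷ r ∷ T ∷ []) ℚ-ring

mainTheorem5 : (a b : ℕ) → .{{_ : NonZero a}} → .{{_ : NonZero b}} →
    (n : ℕ) → (σ : State) → Reachable a b (initial n) σ →
    (∃ λ K → SupportedIn σ K) ×
    (∀ K → SupportedIn σ K →
      IsInteger (leftSum σ ((+ b) / a) K) × IsInteger (rightSum σ ((+ a) / b) K))
mainTheorem5 a b n σ reachable = reachable-supportedIn (initial-supportedIn n) reachable , λ K supp →
    subst IsInteger (sym (leftSum≡weightedSum σ t K))
      (weightedSum-isInteger (leftWeight-vanishesOffRay t) (leftWeight-laplacian a b (fromℕ-*-/-cancel a b))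
                             (+ 1 , refl) reachable K supp)
  , subst IsInteger (sym (rightSum≡weightedSum σ u K))
      (weightedSum-isInteger (rightWeight-vanishesOffRay u) (rightWeight-laplacian a b (fromℕ-*-/-cancel b a))
                             (+ 0 , refl) reachable K supp)
  where
    open Firing a b
    t u : ℚ
    t = + b / a
    u = + a / b
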